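{- For all contexts $\Gamma,\Delta$ and terms $M, A, B$: if $\Gamma\approx_\alpha\Delta$, $A\sim_\alpha B$ and $\Gamma\vdash M:A$, then $\Delta\vdash M:B$.
   Context: Variables $\mathcal{V}$: a type with decidable equality and maps $\mathrm{encode}:\mathcal{V}\to\mathbb{N}$, $\mathrm{decode}:\mathbb{N}\to\mathcal{V}$ with $\mathrm{encode}(\mathrm{decode}\,n)=n$. Constants $\mathcal{C}$: any type. Terms: $\mathsf{c}\,k$, $\mathsf{v}\,x$, $\lambda[x:A]M$, $\Pi[x:A]B$, $M\cdot N$. Free-variable list: $\mathrm{fv}(\mathsf{c}\,k)=[\,]$, $\mathrm{fv}(\mathsf{v}\,x)=[x]$, $\mathrm{fv}(\lambda[x:A]M)=\mathrm{fv}\,A\mathbin{++}(\mathrm{fv}\,M-x)$, likewise $\Pi$, $\mathrm{fv}(M\cdot N)=\mathrm{fv}\,M\mathbin{++}\mathrm{fv}\,N$ ($xs-x$ removes all occurrences of $x$). Substitutions $\sigma:\mathcal{V}\to\Lambda$; $\iota\,x=\mathsf{v}\,x$; $(\sigma,x:=N)$ sends $x$ to $N$, $y\neq x$ to $\sigma\,y$. Fix $\chi':\mathrm{List}\,\mathbb{N}\to\mathbb{N}$ with $\chi'(ns)\notin ns$; $X'(xs)=\mathrm{decode}(\chi'(\mathrm{map\ encode}\ xs))$; $X(\sigma,xs)=X'$(concatenation of $\mathrm{fv}(\sigma\,y)$ for $y$ in $xs$). Substitution: $\mathsf{c}\,k\bullet\sigma=\mathsf{c}\,k$, $\mathsf{v}\,x\bullet\sigma=\sigma\,x$,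 $(M\cdot N)\bullet\sigma=(M\bullet\sigma)\cdot(N\bullet\sigma)$, $(\lambda[x:A]M)\bullet\sigma=\lambda[y:A\bullet\sigma](M\bullet(\sigma,x:=\mathsf{v}\,y))$ with $y=X(\sigma,\mathrm{fv}\,M-x)$, analogously for $\Pi$ (with $y=X(\sigma,\mathrm{fv}\,B-x)$). $M[x:=N]=M\bullet(\iota,x:=N)$. Alpha-conversion $\sim_\alpha$: inductive, $\mathsf{c}\,k\sim_\alpha\mathsf{c}\,k$, $\mathsf{v}\,x\sim_\alpha\mathsf{v}\,x$, congruence for application, and $\lambda[x:A]M\sim_\alpha\lambda[x':A']M'$ whenever $A\sim_\alpha A'$, $y\notin\mathrm{fv}\,M-x$, $y\notin\mathrm{fv}\,M'-x'$ and $M[x:=\mathsf{v}\,y]=M'[x':=\mathsf{v}\,y]$ syntactically, for some $y$ (same for $\Pi$). Beta: the contextual closure of a relation $S$ is the least relation containing $S$ and closed under rewriting in the body or annotation of $\lambda$, in the codomain or domain of $\Pi$, and in either side of an application; $\to_\beta$ is the contextual closure of $(\lambda[x:A]M)\cdot N\ \triangleright\ M[x:=N]$; $\simeq_\beta$ is the reflexive–symmetric–transitive closure of $\sim_\alpha\cup\to_\beta$. PTS: fix $\mathcal{A}\subseteq\mathcal{C}^2$ (axioms) and $\mathcal{R}\subseteq\mathcal{C}^3$ (rules). A context is a list of pairs $(x,A)$; $\Gamma,x:A$ denotes $(x,A)::\Gamma$; $\mathrm{dom}\,\Gamma$ is the list of first components. $\Gamma\approx_\alpha\Delta$ means $\Gamma$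 and $\Delta$ have the same length and the $i$-th entries $(x,A)$ of $\Gamma$ and $(y,B)$ of $\Delta$ satisfy $x=y$ and $A\sim_\alpha B$. The judgments $\Gamma\ \mathrm{ok}$ and $\Gamma\vdash M:A$ are mutually inductively defined by: (nil) $[\,]\ \mathrm{ok}$; (cons) if $\Gamma\ \mathrm{ok}$, $\Gamma\vdash A:\mathsf{c}\,s$ and $x\notin\mathrm{dom}\,\Gamma$ then $(\Gamma,x:A)\ \mathrm{ok}$; (sort) if $\Gamma\ \mathrm{ok}$ and $\mathcal{A}\,s_1\,s_2$ then $\Gamma\vdash\mathsf{c}\,s_1:\mathsf{c}\,s_2$; (prod) if $\Gamma\vdash A:\mathsf{c}\,s_1$, for every $y\notin\mathrm{dom}\,\Gamma$ we have $\Gamma,y:A\vdash B[x:=\mathsf{v}\,y]:\mathsf{c}\,s_2$, and $\mathcal{R}\,s_1\,s_2\,s_3$, then $\Gamma\vdash\Pi[x:A]B:\mathsf{c}\,s_3$; (var) if $\Gamma\ \mathrm{ok}$ and $(x,A)\in\Gamma$ then $\Gamma\vdash\mathsf{v}\,x:A$; (abs) if $\Gamma\vdash A:\mathsf{c}\,s_1$, for every $z\notin\mathrm{dom}\,\Gamma$ both $\Gamma,z:A\vdash B[y:=\mathsf{v}\,z]:\mathsf{c}\,s_2$ and $\Gamma,z:A\vdash M[x:=\mathsf{v}\,z]:B[y:=\mathsf{v}\,z]$, and $\mathcal{R}\,s_1\,s_2\,s_3$, then $\Gamma\vdash\lambda[x:A]M:\Pi[y:A]B$; (app) if $\Gamma\vdash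 M:\Pi[x:A]B$, $\Gamma\vdash N:A$ and $\Gamma\vdash B[x:=N]:\mathsf{c}\,s$, then $\Gamma\vdash M\cdot N:B[x:=N]$; (conv) if $\Gamma\vdash M:A$, $A\simeq_\beta B$ and $\Gamma\vdash B:\mathsf{c}\,s$ then $\Gamma\vdash M:B$. -}

module Defs where

open import Data.Nat using (ℕ)
open import Data.List using (List; []; _∷_; _++_; map; concatMap; filter; length)
open import Data.List.Membership.Propositional using (_∈_; _∉_)
open import Data.Product using (_×_; _,_)
open import Relation.Binary.Definitions using (DecidableEquality)
open import Relation.Binary.PropositionalEquality using (_≡_)
open import Relation.Nullary using (¬_; yes; no)
open import Relation.Nullary.Decidable using (¬?)
open import Relation.Binary.Construct.Closure.Equivalence using (EqClosure)

module Theory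
  {V C : Set}
  (_≟_ : DecidableEquality V)
  (encode : V → ℕ) (decode : ℕ → V)
  (encode-decode : ∀ n → encode (decode n) ≡ n)
  (χ' : List ℕ → ℕ) (χ'-fresh : ∀ ns → χ' ns ∉ ns)
  (Ax : C → C → Set) (Rl : C → C → C → Set)
  where

  infixl 40 _·_
  infix 30 _[_:=_] _•_
  infix 10 _⊢_∶_ _∼α_ _≃β_ _→β_
  infixl 15 _,,_∶_

  data Λ : Set where
    c   : C → Λ
    v   : V → Λ
    lam : V → Λ → Λ → Λ     -- λ[x:A]M  is  lam x A M
    pi  : V → Λ → Λ → Λ     -- Π[x:A]B  is  pi x A B
    _·_ : Λ → Λ → Λ

  _-_ : List V → V → List V
  xs - x = filter (λ y → ¬? (y ≟ x)) xs

  fv : Λ → List V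
  fv (c k) = []
  fv (v x) = x ∷ []
  fv (lam x A M) = fv A ++ (fv M - x)
  fv (pi x A B) = fv A ++ (fv B - x)
  fv (M · N) = fv M ++ fv N

  Subst : Set
  Subst = V → Λ

  ι : Subst
  ι x = v x

  _,_:=_ : Subst → V → Λ → Subst
  (σ , x := N) y with y ≟ x
  ... | yes _ = N
  ... | no _ = σ y

  X' : List V → V
  X' xs = decode (χ' (map encode xs))

  X : Subst → List V → V
  X σ xs = X' (concatMap (λ y → fv (σ y)) xs)

  _•_ : Λ → Subst → Λ
  c k • σ = c k
  v x • σ = σ x
  (M · N) • σ = (M • σ) · (N • σ)
  lam x A M • σ = let y = X σ (fv M - x) in lam y (A • σ) (M • (σ , x := v y))
  pi x A B • σ = let y = X σ (fv B - x) in pi y (A • σ) (B • (σ , x := v y))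

  _[_:=_] : Λ → V → Λ → Λ
  M [ x := N ] = M • (ι , x := N)

  data _∼α_ : Λ → Λ → Set where
    α-c   : ∀ k → c k ∼α c k
    α-v   : ∀ x → v x ∼α v x
    α-app : ∀ {M M' N N'} → M ∼α M' → N ∼α N' → (M · N) ∼α (M' · N')
    α-lam : ∀ {x x' A A' M M'} y → A ∼α A' → y ∉ (fv M - x) → y ∉ (fv M' - x')
          → M [ x := v y ] ≡ M' [ x' := v y ] → lam x A M ∼α lam x' A' M'
    α-pi  : ∀ {x x' A A' M M'} y → A ∼α A' → y ∉ (fv M - x) → y ∉ (fv M' - x')
          → M [ x := v y ] ≡ M' [ x' := v y ] → pi x A M ∼α pi x' A' M'

  data Ctx (S : Λ → Λ → Set) : Λ → Λ → Set where
    base  : ∀ {M N} → S M N → Ctx S M N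
    lamB  : ∀ {x A M M'} → Ctx S M M' → Ctx S (lam x A M) (lam x A M')
    lamA  : ∀ {x A A' M} → Ctx S A A' → Ctx S (lam x A M) (lam x A' M)
    piB   : ∀ {x A B B'} → Ctx S B B' → Ctx S (pi x A B) (pi x A B')
    piA   : ∀ {x A A' B} → Ctx S A A' → Ctx S (pi x A B) (pi x A' B)
    appL  : ∀ {M M' N} → Ctx S M M' → Ctx S (M · N) (M' · N)
    appR  : ∀ {M N N'} → Ctx S N N' → Ctx S (M · N) (M · N')

  data β-redex : Λ → Λ → Set where
    beta : ∀ x A M N → β-redex (lam x A M · N) (M [ x := N ])

  _→β_ : Λ → Λ → Set
  _→β_ = Ctx β-redex

  data _∪α→β_ (M N : Λ) : Set where
    inα : M ∼α N → M ∪α→β N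
    inβ : M →β N → M ∪α→β N

  _≃β_ : Λ → Λ → Set
  _≃β_ = EqClosure _∪α→β_

  Context : Set
  Context = List (V × Λ)

  dom : Context → List V
  dom = map Data.Product.proj₁

  _,,_∶_ : Context → V → Λ → Context
  Γ ,, x ∶ A = (x , A) ∷ Γ

  data _≈α_ : Context → Context → Set where
    []  : [] ≈α []
    _∷_ : ∀ {x A B Γ Δ} → A ∼α B → Γ ≈α Δ → ((x , A) ∷ Γ) ≈α ((x , B) ∷ Δ)

  data _ok : Context → Set
  data _⊢_∶_ : Context → Λ → Λ → Set

  data _ok where
    nil  : [] ok
    cons : ∀ {Γ x A s} → Γ ok → Γ ⊢ A ∶ c s → x ∉ dom Γ → (Γ ,, x ∶ A) ok

  data _⊢_∶_ where
    sort : ∀ {Γ s₁ s₂} → Γ ok → Ax s₁ s₂ → Γ ⊢ c s₁ ∶ c s₂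
    prod : ∀ {Γ x A B s₁ s₂ s₃} → Γ ⊢ A ∶ c s₁
         → (∀ y → y ∉ dom Γ → (Γ ,, y ∶ A) ⊢ B [ x := v y ] ∶ c s₂)
         → Rl s₁ s₂ s₃ → Γ ⊢ pi x A B ∶ c s₃
    var  : ∀ {Γ x A} → Γ ok → (x , A) ∈ Γ → Γ ⊢ v x ∶ A
    abs  : ∀ {Γ x y A B M s₁ s₂ s₃} → Γ ⊢ A ∶ c s₁
         → (∀ z → z ∉ dom Γ → (Γ ,, z ∶ A) ⊢ B [ y := v z ] ∶ c s₂)
         → (∀ z → z ∉ dom Γ → (Γ ,, z ∶ A) ⊢ M [ x := v z ] ∶ B [ y := v z ])
         → Rl s₁ s₂ s₃ → Γ ⊢ lam x A M ∶ pi y A B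
    app  : ∀ {Γ M N x A B s} → Γ ⊢ M ∶ pi x A B → Γ ⊢ N ∶ A
         → Γ ⊢ B [ x := N ] ∶ c s → Γ ⊢ M · N ∶ B [ x := N ]
    conv : ∀ {Γ M A B s} → Γ ⊢ M ∶ A → A ≃β B → Γ ⊢ B ∶ c s → Γ ⊢ M ∶ B

-- Strengthen the statement to also rename the subject (M ∼α M') and induct on the
-- derivation, mutually with validity of contexts. The binder rules quantify over every
-- fresh z, so all that is needed of α-equivalent bodies is that their instances at every
-- z coincide; ∼α only provides this at one fresh w, but composing substitutions renames
-- w to any z (α-binder-•). The remaining mismatches of types (the annotation of a λ,
-- B [ x := N ] against B [ x := N' ]) are absorbed by conv, as ≃β contains ∼α. That
-- B [ x := N ] ∼α B [ x := N' ] holds because α-equivalent terms have equal free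
-- variables, so substitution chooses equal binders for them.
module Submission where

open import Defs
open import Data.Nat using (ℕ)
open import Data.List using (List; []; _∷_; _++_; map; concatMap)
open import Data.List.Properties using (++-identityʳ; filter-++; filter-all; filter-reject; concatMap-++; concatMap-pure)
open import Data.List.Membership.Propositional using (_∈_; _∉_; lose)
open import Data.List.Membership.Propositional.Properties
  using (∈-map⁺; ∈-++⁺ˡ; ∈-++⁺ʳ; ∈-filter⁺; ∈-filter⁻; ∈-concatMap⁺)
open import Data.List.Relation.Unary.All as All using ()
open import Data.List.Relation.Unary.All.Properties using (¬Any⇒All¬)
open import Data.List.Relation.Unary.Any using (here; there)
open import Data.List.Relation.Binary.Subset.Propositional using (_⊆_)
open import Data.List.Relation.Binary.Subset.Propositional.Properties
  using (∷⁺ʳ) renaming (map⁺ to ⊆-map⁺)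
open import Data.Product using (∃; _×_; _,_; proj₁; proj₂; map₂)
open import Function using (_∘_)
open import Relation.Binary.Definitions using (DecidableEquality)
open import Relation.Binary.PropositionalEquality
open import Relation.Nullary using (yes; no; contradiction)
open import Relation.Nullary.Decidable using (¬?)
open import Relation.Binary.Construct.Closure.Equivalence using (return; symmetric)
open import Relation.Binary.Construct.Closure.ReflexiveTransitive using (_◅◅_)

cong₃ : {A B D E : Set} (f : A → B → D → E) {a a' : A} {b b' : B} {d d' : D} →
        a ≡ a' → b ≡ b' → d ≡ d' → f a b d ≡ f a' b' d'
cong₃ f refl refl refl = refl

module AlphaInvariance {V C : Set} (_≟_ : DecidableEquality V)
    (encode : V → ℕ) (decode : ℕ → V)
    (encode-decode : ∀ n → encode (decode n) ≡ n)
    (χ' : List ℕ → ℕ) (χ'-fresh : ∀ ns → χ' ns ∉ ns)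
    (Ax : C → C → Set) (Rl : C → C → C → Set) where
  open Theory _≟_ encode decode encode-decode χ' χ'-fresh Ax Rl
  open ≡-Reasoning

  private variable
    s₁ s₂ s₃ : C
    u w x x' y y' : V
    xs : List V
    A A' B B' M M' N N' T : Λ
    σ σ' : Subst
    Γ Γ' Δ : Context

  ∈-minus⁺ : u ∈ xs → u ≢ x → u ∈ xs - x
  ∈-minus⁺ {x = x} = ∈-filter⁺ (λ y → ¬? (y ≟ x))

  ∉-minus : ∀ x xs → x ∉ xs - x
  ∉-minus x xs x∈ = proj₂ (∈-filter⁻ (λ y → ¬? (y ≟ x)) {xs = xs} x∈) refl

  minus-here : ∀ x xs → (x ∷ xs) - x ≡ xs - x
  minus-here x xs = filter-reject (λ y → ¬? (y ≟ x)) (λ x≢x → x≢x refl)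

  minus-++ : ∀ x xs ys → (xs ++ ys) - x ≡ (xs - x) ++ (ys - x)
  minus-++ x = filter-++ (λ y → ¬? (y ≟ x))

  minus-∉ : x ∉ xs → xs - x ≡ xs
  minus-∉ {x = x} x∉xs = filter-all (λ y → ¬? (y ≟ x)) (All.map (_∘ sym) (¬Any⇒All¬ _ x∉xs))

  X'-fresh : ∀ xs → X' xs ∉ xs
  X'-fresh xs x∈xs = χ'-fresh _ (subst (_∈ map encode xs) (encode-decode _) (∈-map⁺ encode x∈xs))

  fvs : Subst → List V → List V
  fvs σ = concatMap (λ y → fv (σ y))

  ∈-fvs : ∀ σ → u ∈ xs → w ∈ fv (σ u) → w ∈ fvs σ xs
  ∈-fvs σ u∈xs w∈ = ∈-concatMap⁺ (fv ∘ σ) (lose u∈xs w∈)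

  fvs-cong : ∀ σ σ' xs → (∀ u → u ∈ xs → fv (σ u) ≡ fv (σ' u)) → fvs σ xs ≡ fvs σ' xs
  fvs-cong σ σ' [] _ = refl
  fvs-cong σ σ' (u ∷ xs) h = cong₂ _++_ (h u (here refl)) (fvs-cong σ σ' xs (λ w → h w ∘ there))

  X-cong : ∀ σ σ' xs → (∀ u → u ∈ xs → fv (σ u) ≡ fv (σ' u)) → X σ xs ≡ X σ' xs
  X-cong σ σ' xs h = cong X' (fvs-cong σ σ' xs h)

  fvs-ι : ∀ xs → fvs ι xs ≡ xs
  fvs-ι = concatMap-pure

  fvs-upd : ∀ σ x y xs → y ∉ fvs σ (xs - x) → fvs (σ , x := v y) xs - y ≡ fvs σ (xs - x)
  fvs-upd σ x y [] _ = refl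
  fvs-upd σ x y (u ∷ xs) y∉ with u ≟ x
  ... | yes refl = trans (minus-here y _) (fvs-upd σ x y xs y∉)
  ... | no _ = begin
    (fv (σ u) ++ fvs (σ , x := v y) xs) - y        ≡⟨ minus-++ y (fv (σ u)) _ ⟩
    (fv (σ u) - y) ++ (fvs (σ , x := v y) xs - y)  ≡⟨ cong₂ _++_ (minus-∉ (y∉ ∘ ∈-++⁺ˡ))
                                                                 (fvs-upd σ x y xs (y∉ ∘ ∈-++⁺ʳ _)) ⟩
    fv (σ u) ++ fvs σ (xs - x)                     ∎

  mutual
    fv-• : ∀ M σ → fv (M • σ) ≡ fvs σ (fv M)
    fv-• (c k) σ = refl
    fv-• (v x) σ = sym (++-identityʳ _)
    fv-• (M · N) σ = trans (cong₂ _++_ (fv-• M σ) (fv-• N σ)) (sym (concatMap-++ _ (fv M) (fv N)))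
    fv-• (lam x A M) σ = trans (cong₂ _++_ (fv-• A σ) (fv-•-binder M x σ)) (sym (concatMap-++ _ (fv A) _))
    fv-• (pi x A B) σ = trans (cong₂ _++_ (fv-• A σ) (fv-•-binder B x σ)) (sym (concatMap-++ _ (fv A) _))

    fv-•-binder : ∀ M x σ → fv (M • (σ , x := v (X σ (fv M - x)))) - X σ (fv M - x) ≡ fvs σ (fv M - x)
    fv-•-binder M x σ = trans (cong (_- X σ (fv M - x)) (fv-• M _)) (fvs-upd σ x _ (fv M) (X'-fresh _))

  upd-≡ : ∀ σ x N → (σ , x := N) x ≡ N
  upd-≡ σ x N with x ≟ x
  ... | yes _ = refl
  ... | no x≢x = contradiction refl x≢x

  upd-≢ : ∀ σ x N → u ≢ x → (σ , x := N) u ≡ σ u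
  upd-≢ {u} σ x N u≢x with u ≟ x
  ... | yes u≡x = contradiction u≡x u≢x
  ... | no _ = refl

  upd-cong : ∀ x xs → N ≡ N' → (∀ u → u ∈ xs - x → σ u ≡ σ' u) →
             ∀ u → u ∈ xs → (σ , x := N) u ≡ (σ' , x := N') u
  upd-cong x xs N≡N' h u u∈xs with u ≟ x
  ... | yes _ = N≡N'
  ... | no u≢x = h u (∈-minus⁺ u∈xs u≢x)

  •-cong : ∀ M σ σ' → (∀ u → u ∈ fv M → σ u ≡ σ' u) → M • σ ≡ M • σ'
  •-cong (c k) σ σ' h = refl
  •-cong (v x) σ σ' h = h x (here refl)
  •-cong (M · N) σ σ' h = cong₂ _·_ (•-cong M σ σ' (λ u → h u ∘ ∈-++⁺ˡ)) (•-cong N σ σ' (λ u → h u ∘ ∈-++⁺ʳ (fv M)))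
  •-cong (lam x A M) σ σ' h = cong₃ lam y≡y' (•-cong A σ σ' (λ u → h u ∘ ∈-++⁺ˡ))
    (•-cong M _ _ (upd-cong x (fv M) (cong v y≡y') (λ u → h u ∘ ∈-++⁺ʳ (fv A))))
    where
    y≡y' : X σ (fv M - x) ≡ X σ' (fv M - x)
    y≡y' = X-cong σ σ' (fv M - x) (λ u → cong fv ∘ h u ∘ ∈-++⁺ʳ (fv A))
  •-cong (pi x A B) σ σ' h = cong₃ pi y≡y' (•-cong A σ σ' (λ u → h u ∘ ∈-++⁺ˡ))
    (•-cong B _ _ (upd-cong x (fv B) (cong v y≡y') (λ u → h u ∘ ∈-++⁺ʳ (fv A))))
    where
    y≡y' : X σ (fv B - x) ≡ X σ' (fv B - x)
    y≡y' = X-cong σ σ' (fv B - x) (λ u → cong fv ∘ h u ∘ ∈-++⁺ʳ (fv A))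

  •-upd-∉ : ∀ M σ y N → y ∉ fv M → M • (σ , y := N) ≡ M • σ
  •-upd-∉ M σ y N y∉ = •-cong M _ σ (λ u u∈ → upd-≢ σ y N (λ { refl → y∉ u∈ }))

  _⨟_ : Subst → Subst → Subst
  (σ ⨟ τ) u = σ u • τ

  fvs-⨟ : ∀ σ τ xs → fvs τ (fvs σ xs) ≡ fvs (σ ⨟ τ) xs
  fvs-⨟ σ τ [] = refl
  fvs-⨟ σ τ (u ∷ xs) = trans (concatMap-++ _ (fv (σ u)) (fvs σ xs))
                             (cong₂ _++_ (sym (fv-• (σ u) τ)) (fvs-⨟ σ τ xs))

  upd-⨟ : ∀ σ τ x y xs → y ∉ fvs σ (xs - x) →
          ∀ u → u ∈ xs → ((σ , x := v y) ⨟ (τ , y := N)) u ≡ ((σ ⨟ τ) , x := N) u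
  upd-⨟ {N = N} σ τ x y xs y∉ u u∈xs with u ≟ x
  ... | yes _ = upd-≡ τ y N
  ... | no u≢x = •-upd-∉ (σ u) τ y N (y∉ ∘ ∈-fvs σ (∈-minus⁺ u∈xs u≢x))

  X-⨟ : ∀ M x σ τ → let y = X σ (fv M - x) in
        X τ (fv (M • (σ , x := v y)) - y) ≡ X (σ ⨟ τ) (fv M - x)
  X-⨟ M x σ τ = cong X' (trans (cong (fvs τ) (fv-•-binder M x σ)) (fvs-⨟ σ τ (fv M - x)))

  mutual
    •-⨟ : ∀ M σ τ → (M • σ) • τ ≡ M • (σ ⨟ τ)
    •-⨟ (c k) σ τ = refl
    •-⨟ (v x) σ τ = refl
    •-⨟ (M · N) σ τ = cong₂ _·_ (•-⨟ M σ τ) (•-⨟ N σ τ)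
    •-⨟ (lam x A M) σ τ = cong₃ lam (X-⨟ M x σ τ) (•-⨟ A σ τ) (•-⨟-binder M x σ τ)
    •-⨟ (pi x A B) σ τ = cong₃ pi (X-⨟ B x σ τ) (•-⨟ A σ τ) (•-⨟-binder B x σ τ)

    •-⨟-binder : ∀ M x σ τ → let y = X σ (fv M - x) in
      (M • (σ , x := v y)) • (τ , y := v (X τ (fv (M • (σ , x := v y)) - y)))
        ≡ M • ((σ ⨟ τ) , x := v (X (σ ⨟ τ) (fv M - x)))
    •-⨟-binder M x σ τ = begin
      (M • (σ , x := v y₁)) • (τ , y₁ := v y₂)        ≡⟨ •-⨟ M _ _ ⟩
      M • ((σ , x := v y₁) ⨟ (τ , y₁ := v y₂))        ≡⟨ •-cong M _ _ (upd-⨟ σ τ x y₁ (fv M) (X'-fresh _)) ⟩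
      M • ((σ ⨟ τ) , x := v y₂)                      ≡⟨ cong (λ z → M • ((σ ⨟ τ) , x := v z)) (X-⨟ M x σ τ) ⟩
      M • ((σ ⨟ τ) , x := v (X (σ ⨟ τ) (fv M - x)))  ∎
      where
      y₁ y₂ : V
      y₁ = X σ (fv M - x)
      y₂ = X τ (fv (M • (σ , x := v y₁)) - y₁)

  rename-• : ∀ M x w σ N → w ∉ fv M - x → (M [ x := v w ]) • (σ , w := N) ≡ M • (σ , x := N)
  rename-• M x w σ N w∉ = trans (•-⨟ M (ι , x := v w) (σ , w := N))
    (•-cong M _ _ (upd-⨟ ι σ x w (fv M) (subst (w ∉_) (sym (fvs-ι _)) w∉)))

  fv-rename : ∀ M x w → w ∉ fv M - x → fv (M [ x := v w ]) - w ≡ fv M - x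
  fv-rename M x w w∉ = begin
    fv (M [ x := v w ]) - w         ≡⟨ cong (_- w) (fv-• M _) ⟩
    fvs (ι , x := v w) (fv M) - w   ≡⟨ fvs-upd ι x w (fv M) (subst (w ∉_) (sym (fvs-ι _)) w∉) ⟩
    fvs ι (fv M - x)                ≡⟨ fvs-ι _ ⟩
    fv M - x                        ∎

  α-binder-fv : ∀ M M' → w ∉ fv M - x → w ∉ fv M' - x' → M [ x := v w ] ≡ M' [ x' := v w ] →
                fv M - x ≡ fv M' - x'
  α-binder-fv {w} {x} {x'} M M' w∉ w∉' eq = begin
    fv M - x                   ≡⟨ fv-rename M x w w∉ ⟨
    fv (M [ x := v w ]) - w    ≡⟨ cong (λ P → fv P - w) eq ⟩
    fv (M' [ x' := v w ]) - w  ≡⟨ fv-rename M' x' w w∉' ⟩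
    fv M' - x'                 ∎

  α-binder-• : ∀ M M' → w ∉ fv M - x → w ∉ fv M' - x' → M [ x := v w ] ≡ M' [ x' := v w ] →
               ∀ σ N → M • (σ , x := N) ≡ M' • (σ , x' := N)
  α-binder-• {w} {x} {x'} M M' w∉ w∉' eq σ N = begin
    M • (σ , x := N)                    ≡⟨ rename-• M x w σ N w∉ ⟨
    (M [ x := v w ]) • (σ , w := N)     ≡⟨ cong (_• (σ , w := N)) eq ⟩
    (M' [ x' := v w ]) • (σ , w := N)   ≡⟨ rename-• M' x' w σ N w∉' ⟩
    M' • (σ , x' := N)                  ∎

  α-• : M ∼α M' → ∀ σ → M • σ ≡ M' • σ
  α-• (α-c k) σ = refl
  α-• (α-v x) σ = refl
  α-• (α-app M∼M' N∼N') σ = cong₂ _·_ (α-• M∼M' σ) (α-• N∼N' σ)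
  α-• (α-lam {x} {x'} {M = M} {M'} w A∼A' w∉ w∉' eq) σ =
    cong₃ lam y≡y' (α-• A∼A' σ)
      (trans (α-binder-• M M' w∉ w∉' eq σ _) (cong (λ z → M' • (σ , x' := v z)) y≡y'))
    where
    y≡y' : X σ (fv M - x) ≡ X σ (fv M' - x')
    y≡y' = cong (X σ) (α-binder-fv M M' w∉ w∉' eq)
  α-• (α-pi {x} {x'} {M = B} {B'} w A∼A' w∉ w∉' eq) σ =
    cong₃ pi y≡y' (α-• A∼A' σ)
      (trans (α-binder-• B B' w∉ w∉' eq σ _) (cong (λ z → B' • (σ , x' := v z)) y≡y'))
    where
    y≡y' : X σ (fv B - x) ≡ X σ (fv B' - x')
    y≡y' = cong (X σ) (α-binder-fv B B' w∉ w∉' eq)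

  fv-α : M ∼α M' → fv M ≡ fv M'
  fv-α (α-c k) = refl
  fv-α (α-v x) = refl
  fv-α (α-app M∼M' N∼N') = cong₂ _++_ (fv-α M∼M') (fv-α N∼N')
  fv-α (α-lam {M = M} {M'} w A∼A' w∉ w∉' eq) = cong₂ _++_ (fv-α A∼A') (α-binder-fv M M' w∉ w∉' eq)
  fv-α (α-pi {M = B} {B'} w A∼A' w∉ w∉' eq) = cong₂ _++_ (fv-α A∼A') (α-binder-fv B B' w∉ w∉' eq)

  α-refl : ∀ M → M ∼α M
  α-refl (c k) = α-c k
  α-refl (v x) = α-v x
  α-refl (M · N) = α-app (α-refl M) (α-refl N)
  α-refl (lam x A M) = α-lam x (α-refl A) (∉-minus x (fv M)) (∉-minus x (fv M)) refl
  α-refl (pi x A B) = α-pi x (α-refl A) (∉-minus x (fv B)) (∉-minus x (fv B)) refl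

  ≡⇒∼α : M ≡ M' → M ∼α M'
  ≡⇒∼α {M} refl = α-refl M

  lam-α-cong : y ≡ y' → A ∼α A' → M ∼α M' → lam y A M ∼α lam y' A' M'
  lam-α-cong {y} {M = M} {M'} refl A∼A' M∼M' =
    α-lam y A∼A' (∉-minus y (fv M)) (∉-minus y (fv M')) (α-• M∼M' (ι , y := v y))

  pi-α-cong : y ≡ y' → A ∼α A' → B ∼α B' → pi y A B ∼α pi y' A' B'
  pi-α-cong {y} {B = B} {B'} refl A∼A' B∼B' =
    α-pi y A∼A' (∉-minus y (fv B)) (∉-minus y (fv B')) (α-• B∼B' (ι , y := v y))

  upd-α : ∀ x → (∀ u → σ u ∼α σ' u) → N ∼α N' → ∀ u → (σ , x := N) u ∼α (σ' , x := N') u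
  upd-α x σ∼σ' N∼N' u with u ≟ x
  ... | yes _ = N∼N'
  ... | no _ = σ∼σ' u

  •-α : ∀ M σ σ' → (∀ u → σ u ∼α σ' u) → M • σ ∼α M • σ'
  •-α (c k) σ σ' σ∼σ' = α-c k
  •-α (v x) σ σ' σ∼σ' = σ∼σ' x
  •-α (M · N) σ σ' σ∼σ' = α-app (•-α M σ σ' σ∼σ') (•-α N σ σ' σ∼σ')
  •-α (lam x A M) σ σ' σ∼σ' =
    lam-α-cong y≡y' (•-α A σ σ' σ∼σ') (•-α M _ _ (upd-α x σ∼σ' (≡⇒∼α (cong v y≡y'))))
    where
    y≡y' : X σ (fv M - x) ≡ X σ' (fv M - x)
    y≡y' = X-cong σ σ' (fv M - x) (λ u _ → fv-α (σ∼σ' u))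
  •-α (pi x A B) σ σ' σ∼σ' =
    pi-α-cong y≡y' (•-α A σ σ' σ∼σ') (•-α B _ _ (upd-α x σ∼σ' (≡⇒∼α (cong v y≡y'))))
    where
    y≡y' : X σ (fv B - x) ≡ X σ' (fv B - x)
    y≡y' = X-cong σ σ' (fv B - x) (λ u _ → fv-α (σ∼σ' u))

  [:=]-α : ∀ M x → N ∼α N' → M [ x := N ] ∼α M [ x := N' ]
  [:=]-α M x N∼N' = •-α M _ _ (upd-α x α-v N∼N')

  α⇒≃β : A ∼α B → A ≃β B
  α⇒≃β = return ∘ inα

  ≃β-via-α : A ∼α B → A ∼α T → B ≃β T
  ≃β-via-α A∼B A∼T = symmetric _ (α⇒≃β A∼B) ◅◅ α⇒≃β A∼T

  dom-≈α : Γ ≈α Δ → dom Γ ≡ dom Δ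
  dom-≈α [] = refl
  dom-≈α (_∷_ {x} _ Γ≈Δ) = cong (x ∷_) (dom-≈α Γ≈Δ)

  ∉-dom-≈α : Γ ≈α Δ → y ∉ dom Δ → y ∉ dom Γ
  ∉-dom-≈α Γ≈Δ y∉ = y∉ ∘ subst (_ ∈_) (dom-≈α Γ≈Δ)

  ∈-≈α : Γ ≈α Δ → (x , A) ∈ Γ → ∃ λ B → (x , B) ∈ Δ × A ∼α B
  ∈-≈α (A∼B ∷ _) (here refl) = _ , here refl , A∼B
  ∈-≈α (_ ∷ Γ≈Δ) (there x∈Γ) with ∈-≈α Γ≈Δ x∈Γ
  ... | B , x∈Δ , A∼B = B , there x∈Δ , A∼B

  ⊢-weaken : Γ ⊢ M ∶ A → Γ ⊆ Γ' → Γ' ok → Γ' ⊢ M ∶ A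
  ⊢-weaken (sort _ ax) Γ⊆Γ' Γ'ok = sort Γ'ok ax
  ⊢-weaken (var _ x∈Γ) Γ⊆Γ' Γ'ok = var Γ'ok (Γ⊆Γ' x∈Γ)
  ⊢-weaken (prod ⊢A ⊢B r) Γ⊆Γ' Γ'ok = prod ⊢A'
    (λ y y∉ → ⊢-weaken (⊢B y (y∉ ∘ ⊆-map⁺ proj₁ Γ⊆Γ')) (∷⁺ʳ _ Γ⊆Γ') (cons Γ'ok ⊢A' y∉)) r
    where ⊢A' = ⊢-weaken ⊢A Γ⊆Γ' Γ'ok
  ⊢-weaken (abs ⊢A ⊢B ⊢M r) Γ⊆Γ' Γ'ok = abs ⊢A'
    (λ z z∉ → ⊢-weaken (⊢B z (z∉ ∘ ⊆-map⁺ proj₁ Γ⊆Γ')) (∷⁺ʳ _ Γ⊆Γ') (cons Γ'ok ⊢A' z∉))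
    (λ z z∉ → ⊢-weaken (⊢M z (z∉ ∘ ⊆-map⁺ proj₁ Γ⊆Γ')) (∷⁺ʳ _ Γ⊆Γ') (cons Γ'ok ⊢A' z∉)) r
    where ⊢A' = ⊢-weaken ⊢A Γ⊆Γ' Γ'ok
  ⊢-weaken (app ⊢M ⊢N ⊢B) Γ⊆Γ' Γ'ok =
    app (⊢-weaken ⊢M Γ⊆Γ' Γ'ok) (⊢-weaken ⊢N Γ⊆Γ' Γ'ok) (⊢-weaken ⊢B Γ⊆Γ' Γ'ok)
  ⊢-weaken (conv ⊢M A≃B ⊢B) Γ⊆Γ' Γ'ok = conv (⊢-weaken ⊢M Γ⊆Γ' Γ'ok) A≃B (⊢-weaken ⊢B Γ⊆Γ' Γ'ok)

  mutual
    ⊢-α : Γ ⊢ M ∶ A → Γ ≈α Δ → M ∼α M' → A ∼α T → Δ ⊢ M' ∶ T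
    ⊢-α (sort Γok ax) Γ≈Δ (α-c _) (α-c _) = sort (ok-α Γok Γ≈Δ) ax
    ⊢-α (var Γok x∈Γ) Γ≈Δ (α-v x) A∼T with ∈-≈α Γ≈Δ x∈Γ
    ... | B , x∈Δ , A∼B =
      conv (var (ok-α Γok Γ≈Δ) x∈Δ) (≃β-via-α A∼B A∼T) (proj₂ (entry-sorted-α Γok x∈Γ Γ≈Δ A∼T))
    ⊢-α (prod ⊢A ⊢B r) Γ≈Δ Π∼Π' (α-c _) = prod-α ⊢A ⊢B r Γ≈Δ Π∼Π'
    -- abs forces the Π-domain to be the λ-annotation, so the λ is typed at pi y A' B
    -- and then converted.
    ⊢-α (abs {B = B} ⊢A ⊢B ⊢M r) Γ≈Δ (α-lam {M = M} {M'} w A∼A' w∉ w∉' eq) Π∼T =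
      conv (abs (⊢-α ⊢A Γ≈Δ A∼A' (α-c _))
                (λ z z∉ → ⊢-α (⊢B z (∉-dom-≈α Γ≈Δ z∉)) (A∼A' ∷ Γ≈Δ) (α-refl _) (α-c _))
                (λ z z∉ → ⊢-α (⊢M z (∉-dom-≈α Γ≈Δ z∉)) (A∼A' ∷ Γ≈Δ)
                              (≡⇒∼α (α-binder-• M M' w∉ w∉' eq ι (v z))) (α-refl _))
                r)
           (≃β-via-α (pi-α-cong refl A∼A' (α-refl B)) Π∼T)
           (prod-α ⊢A ⊢B r Γ≈Δ Π∼T)
    ⊢-α (app {x = x} {B = B} ⊢M ⊢N ⊢B[N]) Γ≈Δ (α-app M∼M' N∼N') B[N]∼T =
      conv (app (⊢-α ⊢M Γ≈Δ M∼M' (α-refl _)) (⊢-α ⊢N Γ≈Δ N∼N' (α-refl _))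
                (⊢-α ⊢B[N] Γ≈Δ B[N]∼B[N'] (α-c _)))
           (≃β-via-α B[N]∼B[N'] B[N]∼T)
           (⊢-α ⊢B[N] Γ≈Δ B[N]∼T (α-c _))
      where B[N]∼B[N'] = [:=]-α B x N∼N'
    ⊢-α (conv ⊢M A≃B ⊢B) Γ≈Δ M∼M' B∼T =
      conv (⊢-α ⊢M Γ≈Δ M∼M' (α-refl _)) (A≃B ◅◅ α⇒≃β B∼T) (⊢-α ⊢B Γ≈Δ B∼T (α-c _))

    prod-α : Γ ⊢ A ∶ c s₁ → (∀ y → y ∉ dom Γ → (Γ ,, y ∶ A) ⊢ B [ x := v y ] ∶ c s₂) →
             Rl s₁ s₂ s₃ → Γ ≈α Δ → pi x A B ∼α T → Δ ⊢ T ∶ c s₃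
    prod-α ⊢A ⊢B r Γ≈Δ (α-pi {M = B} {B'} w A∼A' w∉ w∉' eq) =
      prod (⊢-α ⊢A Γ≈Δ A∼A' (α-c _))
           (λ y y∉ → ⊢-α (⊢B y (∉-dom-≈α Γ≈Δ y∉)) (A∼A' ∷ Γ≈Δ)
                         (≡⇒∼α (α-binder-• B B' w∉ w∉' eq ι (v y))) (α-c _))
           r

    ok-α : Γ ok → Γ ≈α Δ → Δ ok
    ok-α nil [] = nil
    ok-α (cons Γok ⊢A x∉) (A∼B ∷ Γ≈Δ) =
      cons (ok-α Γok Γ≈Δ) (⊢-α ⊢A Γ≈Δ A∼B (α-c _)) (x∉ ∘ subst (_ ∈_) (sym (dom-≈α Γ≈Δ)))

    -- The sort of a context entry is derived inside the proof of Γ ok, not inside the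
    -- var derivation; that is why this is part of the mutual induction.
    entry-sorted-α : Γ ok → (x , A) ∈ Γ → Γ ≈α Δ → A ∼α T → ∃ λ s → Δ ⊢ T ∶ c s
    entry-sorted-α Γ'ok@(cons {s = s} _ ⊢A _) (here refl) Γ'≈Δ'@(_ ∷ Γ≈Δ) A∼T =
      s , ⊢-weaken (⊢-α ⊢A Γ≈Δ A∼T (α-c s)) there (ok-α Γ'ok Γ'≈Δ')
    entry-sorted-α Γ'ok@(cons Γok _ _) (there x∈Γ) Γ'≈Δ'@(_ ∷ Γ≈Δ) A∼T =
      map₂ (λ ⊢T → ⊢-weaken ⊢T there (ok-α Γ'ok Γ'≈Δ')) (entry-sorted-α Γok x∈Γ Γ≈Δ A∼T)

corollary2 : {V C : Set} (_≟_ : DecidableEquality V)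
    (encode : V → ℕ) (decode : ℕ → V)
    (encode-decode : ∀ n → encode (decode n) ≡ n)
    (χ' : List ℕ → ℕ) (χ'-fresh : ∀ ns → χ' ns ∉ ns)
    (Ax : C → C → Set) (Rl : C → C → C → Set) →
    let open Theory _≟_ encode decode encode-decode χ' χ'-fresh Ax Rl in
    ∀ (Γ Δ : Context) (M A B : Λ) →
    Γ ≈α Δ → A ∼α B → Γ ⊢ M ∶ A → Δ ⊢ M ∶ B
corollary2 _≟_ encode decode encode-decode χ' χ'-fresh Ax Rl Γ Δ M A B Γ≈Δ A∼B ⊢M =
  ⊢-α ⊢M Γ≈Δ (α-refl M) A∼B
  where open AlphaInvariance _≟_ encode decode encode-decode χ' χ'-fresh Ax Rl
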